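{- Let $G$ be a finite group and $U\subseteq G$ with $|U|\ge 2$. The following are equivalent: (i) $U$ is an equivalence class of the relation $\equiv$ on $G$ and $U$ is an independent set in $\mathcal P_G$; (ii) $U$ is the set of all maximal involutions of $G$; (iii) $U$ is a maximal (with respect to inclusion) homogeneous antichain in the poset $L_G$.
   Context: $\mathcal P_G$ is the power graph (vertex set $G$, distinct elements adjacent iff one is a power of the other); $N(x)$ is the set of neighbours of $x$ in $\mathcal P_G$ and $N[x]=N(x)\cup\{x\}$. Define $x\equiv y$ iff $N(x)=N(y)$ or $N[x]=N[y]$; this is an equivalence relation. A maximal involution is an element $x$ of order $2$ with $\langle x\rangle$ a maximal cyclic subgroup of $G$. Poset $L_G$: for $x\in G$ let $[x]$ be the set of generators of $\langle x\rangle$; fix an arbitrary linear order on each such set; $x\prec y$ iff ($[x]=[y]$ and $x$ precedes $y$) or $\langle x\rangle\subsetneqq\langle y\rangle$; $L_G=(G,\preceq)$ where $x\preceq y$ iff $x\prec y$ or $x=y$. A subset $S$ of a poset is an antichain if its elements are pairwise incomparable, a chain if pairwise comparable, and homogeneous if for every $y\notin S$ either $x\le y$ for all $x\in S$, or $y\le x$ for all $x\in S$, or $y$ is incomparable with every $x\in S$. -}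

module Defs where

open import Level using (0ℓ)
open import Data.Nat using (ℕ; zero; suc)
open import Data.Fin using (Fin)
open import Data.Product using (Σ; ∃; _×_; _,_)
open import Data.Sum using (_⊎_)
open import Relation.Nullary using (¬_)
open import Relation.Binary.PropositionalEquality using (_≡_; _≢_)
open import Relation.Binary using (Rel)
open import Relation.Binary.Structures using (IsStrictTotalOrder)
open import Relation.Unary using (Pred; _∈_; _∉_; _⊆_)
open import Algebra.Structures using (IsGroup)
open import Function.Bundles using (_⇔_)

-- A finite group: a group (in the stdlib sense, with propositional equality)
-- whose carrier is Fin n.  Every finite group is isomorphic to one of these.
record FiniteGroup : Set₁ where
  field
    n       : ℕ
    _∙_     : Fin n → Fin n → Fin n
    ε       : Fin n
    _⁻¹     : Fin n → Fin n
    isGroup : IsGroup _≡_ _∙_ ε _⁻¹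

module _ (G : FiniteGroup) where
  open FiniteGroup G

  Elt : Set
  Elt = Fin n

  pow : Elt → ℕ → Elt
  pow x zero    = ε
  pow x (suc k) = x ∙ pow x k

  -- y is a power of x, i.e. y ∈ ⟨x⟩  (G finite, so ℕ-powers suffice)
  IsPowerOf : Elt → Elt → Set
  IsPowerOf y x = ∃ λ k → y ≡ pow x k

  Adj : Elt → Elt → Set
  Adj x y = x ≢ y × (IsPowerOf y x ⊎ IsPowerOf x y)

  OpenNbhdEq : Elt → Elt → Set
  OpenNbhdEq x y = ∀ z → (Adj x z ⇔ Adj y z)

  ClosedNbhdEq : Elt → Elt → Set
  ClosedNbhdEq x y = ∀ z → ((z ≡ x ⊎ Adj x z) ⇔ (z ≡ y ⊎ Adj y z))

  NbhdEquiv : Elt → Elt → Set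
  NbhdEquiv x y = OpenNbhdEq x y ⊎ ClosedNbhdEq x y

  IsEquivClass : Pred Elt 0ℓ → Set
  IsEquivClass U = ∃ λ x → ∀ y → (y ∈ U ⇔ NbhdEquiv x y)

  IsIndependent : Pred Elt 0ℓ → Set
  IsIndependent U = ∀ x y → x ∈ U → y ∈ U → ¬ Adj x y

  IsMaximalInvolution : Elt → Set
  IsMaximalInvolution x =
    x ≢ ε × (x ∙ x) ≡ ε × (∀ y → IsPowerOf x y → IsPowerOf y x)

  -- The arbitrary linear orders on the generator sets [x]
  -- are given as the restrictions of a strict total order _<ₗ_ on G
  -- (every family of linear orders on the classes arises this way).
  module LG (_<ₗ_ : Rel Elt 0ℓ) where

    SameGen : Elt → Elt → Set
    SameGen x y = IsPowerOf x y × IsPowerOf y x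

    ProperSub : Elt → Elt → Set
    ProperSub x y = IsPowerOf x y × ¬ IsPowerOf y x

    _≺_ : Elt → Elt → Set
    x ≺ y = (SameGen x y × x <ₗ y) ⊎ ProperSub x y

    _≼_ : Elt → Elt → Set
    x ≼ y = x ≺ y ⊎ x ≡ y

    Incomparable : Elt → Elt → Set
    Incomparable x y = ¬ (x ≼ y) × ¬ (y ≼ x)

    IsAntichain : Pred Elt 0ℓ → Set
    IsAntichain S = ∀ x y → x ∈ S → y ∈ S → x ≢ y → Incomparable x y

    IsHomogeneous : Pred Elt 0ℓ → Set
    IsHomogeneous S = ∀ y → y ∉ S →
        (∀ x → x ∈ S → x ≼ y)
      ⊎ (∀ x → x ∈ S → y ≼ x)
      ⊎ (∀ x → x ∈ S → Incomparable x y)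

    IsHomogeneousAntichain : Pred Elt 0ℓ → Set
    IsHomogeneousAntichain S = IsAntichain S × IsHomogeneous S

    IsMaximalHomogeneousAntichain : Pred Elt 0ℓ → Set₁
    IsMaximalHomogeneousAntichain S =
      IsHomogeneousAntichain S ×
      (∀ (T : Pred Elt 0ℓ) → IsHomogeneousAntichain T → S ⊆ T → T ⊆ S)

  HasTwoElements : Pred Elt 0ℓ → Set
  HasTwoElements U = ∃ λ x → ∃ λ y → x ∈ U × y ∈ U × x ≢ y

-- The maximal involutions are exactly the non-identity elements whose only neighbour in
-- 𝒫_G is ε: if x² ≠ ε then x is adjacent to x⁻¹ ≠ x, and a cyclic subgroup properly
-- containing ⟨x⟩ is generated by another neighbour.  Hence they form an independent class
-- of ≡.  Conversely, distinct non-adjacent u, v with N(u) = N(v) are maximal involutions,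
-- since a cyclic group ⟨z⟩ ⊋ ⟨u⟩ would have to contain v, and a cyclic group has at most
-- one involution.  In L_G elements related by powers are comparable, so an antichain S
-- meets ⟨t⟩ only in t for t ∈ S; applying homogeneity to t⁻¹, and to a generator z of a
-- cyclic overgroup of ⟨t⟩, against a second element of S shows that t is a maximal
-- involution.
module Submission where

open import Defs
open import Level using (0ℓ)
open import Algebra.Bundles using (Group)
open import Algebra.Structures using (IsGroup)
import Algebra.Properties.Group as GroupProperties
open import Data.Empty using (⊥-elim)
open import Data.Fin using (toℕ)
open import Data.Fin.Properties using (pigeonhole; _≟_)
open import Data.Nat using (ℕ; zero; suc; _+_; _*_; _∸_; _<_; _<?_; NonZero; >-nonZero)
open import Data.Nat.DivMod using (_%_; _/_; m≡m%n+[m/n]*n; m%n<n; m<n⇒m%n≡m; m≤n⇒[n∸m]%m≡n%m)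
open import Data.Nat.Induction using (<-rec)
open import Data.Nat.Properties
  using (n<1+n; m<n⇒0<n∸m; m+[n∸m]≡n; <⇒≤; ≮⇒≥; ≤-antisym; n≢0⇒n>0; n>0⇒n≢0;
         +-mono-<; m<n+o⇒m∸n<o; m∸n≡0⇒m≤n; *-cancelˡ-≡; +-identityʳ; anyUpTo?)
  renaming (_≟_ to _≟ℕ_)
open import Data.Product using (∃; _×_; _,_; proj₁; proj₂)
open import Data.Sum using (_⊎_; inj₁; inj₂; [_,_]′; swap)
open import Function.Base using (_∘_; id)
open import Function.Bundles using (_⇔_; mk⇔; Equivalence)
open import Function.Construct.Identity using (⇔-id)
open import Function.Construct.Symmetry using (⇔-sym)
open import Function.Construct.Composition using (_⇔-∘_)
open import Relation.Binary using (Rel; tri<; tri≈; tri>)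
open import Relation.Binary.PropositionalEquality
open import Relation.Binary.Structures using (IsStrictTotalOrder)
open import Relation.Nullary using (¬_; yes; no; contradiction)
open import Relation.Nullary.Decidable using (_×-dec_)
open import Relation.Unary using (Pred; Decidable; _∈_; _∉_)

open Equivalence using (to; from)

LeastWitness : ∀ {p} → Pred ℕ p → Pred ℕ p
LeastWitness P m = P m × (∀ {k} → k < m → ¬ P k)

leastWitness : ∀ {p} {P : Pred ℕ p} → Decidable P → ∀ {n} → P n → ∃ (LeastWitness P)
leastWitness {P = P} P? {n} = <-rec (λ n → P n → ∃ (LeastWitness P)) search n
  where
  search : ∀ n → (∀ {k} → k < n → P k → ∃ (LeastWitness P)) → P n → ∃ (LeastWitness P)
  search n below Pn with anyUpTo? P? n
  ... | yes (k , k<n , Pk) = below k<n Pk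
  ... | no ¬smaller        = n , Pn , λ k<n Pk → ¬smaller (_ , k<n , Pk)

[r+r]%m≡0⇒r+r≡m : ∀ {r m} .{{_ : NonZero m}} → 0 < r → r < m → (r + r) % m ≡ 0 → r + r ≡ m
[r+r]%m≡0⇒r+r≡m {r} {m} 0<r r<m [r+r]%m≡0 with r + r <? m
... | yes r+r<m = contradiction (trans (sym (m<n⇒m%n≡m r+r<m)) [r+r]%m≡0)
                                (n>0⇒n≢0 (+-mono-< 0<r 0<r))
... | no r+r≮m  = ≤-antisym (m∸n≡0⇒m≤n excess≡0) m≤r+r
  where
  m≤r+r = ≮⇒≥ r+r≮m
  excess≡0 : r + r ∸ m ≡ 0
  excess≡0 = trans (sym (m<n⇒m%n≡m (m<n+o⇒m∸n<o (r + r) m (+-mono-< r<m r<m))))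
                   (trans (m≤n⇒[n∸m]%m≡n%m m≤r+r) [r+r]%m≡0)

r+r≡s+s⇒r≡s : ∀ {r s} → r + r ≡ s + s → r ≡ s
r+r≡s+s⇒r≡s {r} {s} eq = *-cancelˡ-≡ r s 2
  (trans (cong (r +_) (+-identityʳ r)) (trans eq (sym (cong (s +_) (+-identityʳ s)))))

module _ (G : FiniteGroup) where
  open FiniteGroup G
  open IsGroup isGroup using (assoc; identityˡ; identityʳ; inverseʳ)

  private
    group : Group 0ℓ 0ℓ
    group = record { isGroup = isGroup }

  open GroupProperties group using (∙-cancelˡ; inverseʳ-unique; ⁻¹-involutive)

  infixr 30 _^_
  _^_ : Elt G → ℕ → Elt G
  _^_ = pow G

  infix 4 _∈⟨_⟩
  _∈⟨_⟩ : Elt G → Elt G → Set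
  y ∈⟨ x ⟩ = IsPowerOf G y x

  ^-+ : ∀ x a b → x ^ (a + b) ≡ x ^ a ∙ x ^ b
  ^-+ x zero    b = sym (identityˡ _)
  ^-+ x (suc a) b = trans (cong (x ∙_) (^-+ x a b)) (sym (assoc _ _ _))

  ^-* : ∀ x a b → (x ^ a) ^ b ≡ x ^ (b * a)
  ^-* x a zero    = refl
  ^-* x a (suc b) = trans (cong (x ^ a ∙_) (^-* x a b)) (sym (^-+ x a (b * a)))

  ε^ : ∀ k → ε ^ k ≡ ε
  ε^ zero    = refl
  ε^ (suc k) = trans (identityˡ (ε ^ k)) (ε^ k)

  ∈⟨⟩-refl : ∀ x → x ∈⟨ x ⟩
  ∈⟨⟩-refl x = 1 , sym (identityʳ x)

  ∈⟨⟩-trans : ∀ {x y z} → x ∈⟨ y ⟩ → y ∈⟨ z ⟩ → x ∈⟨ z ⟩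
  ∈⟨⟩-trans {z = z} (b , refl) (a , refl) = b * a , ^-* z a b

  ε∈⟨⟩ : ∀ x → ε ∈⟨ x ⟩
  ε∈⟨⟩ x = 0 , refl

  ∈⟨ε⟩ : ∀ {x} → x ∈⟨ ε ⟩ → x ≡ ε
  ∈⟨ε⟩ (k , refl) = ε^ k

  IsPeriod : Elt G → Pred ℕ 0ℓ
  IsPeriod x k = 0 < k × x ^ k ≡ ε

  isPeriod? : ∀ x → Decidable (IsPeriod x)
  isPeriod? x k = (0 <? k) ×-dec (x ^ k ≟ ε)

  -- Two of the n + 1 powers x⁰, …, xⁿ of an element of a group of order n coincide.
  period : ∀ x → ∃ (IsPeriod x)
  period x with i , j , i<j , xⁱ≡xʲ ← pigeonhole (n<1+n n) (λ i → x ^ toℕ i) =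
    toℕ j ∸ toℕ i , m<n⇒0<n∸m i<j , sym (∙-cancelˡ (x ^ toℕ i) _ _ (begin
      x ^ toℕ i ∙ ε                       ≡⟨ identityʳ _ ⟩
      x ^ toℕ i                           ≡⟨ xⁱ≡xʲ ⟩
      x ^ toℕ j                           ≡⟨ cong (x ^_) (m+[n∸m]≡n (<⇒≤ i<j)) ⟨
      x ^ (toℕ i + (toℕ j ∸ toℕ i))       ≡⟨ ^-+ x (toℕ i) _ ⟩
      x ^ toℕ i ∙ x ^ (toℕ j ∸ toℕ i)     ∎))
    where open ≡-Reasoning

  ⁻¹∈⟨⟩ : ∀ x → x ⁻¹ ∈⟨ x ⟩
  ⁻¹∈⟨⟩ x with period x
  ... | suc k , _ , xᵏ⁺¹≡ε = k , sym (inverseʳ-unique x (x ^ k) xᵏ⁺¹≡ε)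

  ∈⟨⁻¹⟩ : ∀ x → x ∈⟨ x ⁻¹ ⟩
  ∈⟨⁻¹⟩ x = subst (_∈⟨ x ⁻¹ ⟩) (⁻¹-involutive x) (⁻¹∈⟨⟩ (x ⁻¹))

  ⁻¹≢ : ∀ {x} → x ∙ x ≢ ε → x ⁻¹ ≢ x
  ⁻¹≢ {x} x²≢ε x⁻¹≡x = x²≢ε (trans (cong (x ∙_) (sym x⁻¹≡x)) (inverseʳ x))

  ∈⟨involution⟩ : ∀ {x y} → x ∙ x ≡ ε → y ∈⟨ x ⟩ → y ≡ ε ⊎ y ≡ x
  ∈⟨involution⟩ {x} x²≡ε (k , refl) = powers k
    where
    powers : ∀ k → x ^ k ≡ ε ⊎ x ^ k ≡ x
    powers zero = inj₁ refl
    powers (suc k) with powers k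
    ... | inj₁ xᵏ≡ε = inj₂ (trans (cong (x ∙_) xᵏ≡ε) (identityʳ x))
    ... | inj₂ xᵏ≡x = inj₁ (trans (cong (x ∙_) xᵏ≡x) x²≡ε)

  ^-% : ∀ {x m} .{{_ : NonZero m}} → x ^ m ≡ ε → ∀ a → x ^ a ≡ x ^ (a % m)
  ^-% {x} {m} xᵐ≡ε a = begin
    x ^ a                                ≡⟨ cong (x ^_) (m≡m%n+[m/n]*n a m) ⟩
    x ^ (a % m + a / m * m)              ≡⟨ ^-+ x (a % m) _ ⟩
    x ^ (a % m) ∙ x ^ (a / m * m)        ≡⟨ cong (x ^ (a % m) ∙_) (^-* x m (a / m)) ⟨
    x ^ (a % m) ∙ (x ^ m) ^ (a / m)      ≡⟨ cong (λ y → x ^ (a % m) ∙ y ^ (a / m)) xᵐ≡ε ⟩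
    x ^ (a % m) ∙ ε ^ (a / m)            ≡⟨ cong (x ^ (a % m) ∙_) (ε^ (a / m)) ⟩
    x ^ (a % m) ∙ ε                      ≡⟨ identityʳ _ ⟩
    x ^ (a % m)                          ∎
    where open ≡-Reasoning

  leastPeriod-divides : ∀ {x m k} .{{_ : NonZero m}} → LeastWitness (IsPeriod x) m →
                        x ^ k ≡ ε → k % m ≡ 0
  leastPeriod-divides {m = m} {k} ((_ , xᵐ≡ε) , smaller) xᵏ≡ε with k % m ≟ℕ 0
  ... | yes k%m≡0 = k%m≡0
  ... | no  k%m≢0 = ⊥-elim (smaller (m%n<n k m) (n≢0⇒n>0 k%m≢0 , trans (sym (^-% xᵐ≡ε k)) xᵏ≡ε))

  IsInvolution : Elt G → Set
  IsInvolution x = x ≢ ε × x ∙ x ≡ ε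

  involution-halfPeriod : ∀ {z t m} .{{_ : NonZero m}} → LeastWitness (IsPeriod z) m →
                          t ∈⟨ z ⟩ → IsInvolution t → ∃ λ r → r + r ≡ m × t ≡ z ^ r
  involution-halfPeriod {z} {t} {m} least@((_ , zᵐ≡ε) , _) (a , t≡zᵃ) (t≢ε , t²≡ε) =
    a % m , [r+r]%m≡0⇒r+r≡m 0<r (m%n<n a m) (leastPeriod-divides least z²ʳ≡ε) , t≡zʳ
    where
    t≡zʳ : t ≡ z ^ (a % m)
    t≡zʳ = trans t≡zᵃ (^-% zᵐ≡ε a)
    0<r : 0 < a % m
    0<r = n≢0⇒n>0 λ r≡0 → t≢ε (trans t≡zʳ (cong (z ^_) r≡0))
    z²ʳ≡ε : z ^ (a % m + a % m) ≡ ε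
    z²ʳ≡ε = trans (^-+ z (a % m) (a % m)) (trans (cong₂ _∙_ (sym t≡zʳ) (sym t≡zʳ)) t²≡ε)

  cyclic-involution-unique : ∀ {z t u} → t ∈⟨ z ⟩ → u ∈⟨ z ⟩ →
                             IsInvolution t → IsInvolution u → t ≡ u
  cyclic-involution-unique {z} t∈⟨z⟩ u∈⟨z⟩ inv-t inv-u
    with m , least@((0<m , _) , _) ← leastWitness (isPeriod? z) (proj₂ (period z))
    with r , r+r≡m , t≡zʳ ← involution-halfPeriod {{>-nonZero 0<m}} least t∈⟨z⟩ inv-t
    with s , s+s≡m , u≡zˢ ← involution-halfPeriod {{>-nonZero 0<m}} least u∈⟨z⟩ inv-u
    = trans t≡zʳ (trans (cong (z ^_) (r+r≡s+s⇒r≡s {r} {s} (trans r+r≡m (sym s+s≡m)))) (sym u≡zˢ))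

  Adj-sym : ∀ {x y} → Adj G x y → Adj G y x
  Adj-sym (x≢y , related) = ≢-sym x≢y , swap related

  ε-Adj : ∀ {x} → x ≢ ε → Adj G ε x
  ε-Adj x≢ε = ≢-sym x≢ε , inj₂ (ε∈⟨⟩ _)

  Adj-⁻¹ : ∀ {x} → x ∙ x ≢ ε → Adj G x (x ⁻¹)
  Adj-⁻¹ x²≢ε = ≢-sym (⁻¹≢ x²≢ε) , inj₁ (⁻¹∈⟨⟩ _)

  Adj-⁻¹⇒Adj : ∀ {x y} → y ≢ x → Adj G y (x ⁻¹) → Adj G y x
  Adj-⁻¹⇒Adj y≢x (_ , inj₁ x⁻¹∈⟨y⟩) = y≢x , inj₁ (∈⟨⟩-trans (∈⟨⁻¹⟩ _) x⁻¹∈⟨y⟩)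
  Adj-⁻¹⇒Adj y≢x (_ , inj₂ y∈⟨x⁻¹⟩) = y≢x , inj₂ (∈⟨⟩-trans y∈⟨x⁻¹⟩ (⁻¹∈⟨⟩ _))

  MI : Elt G → Set
  MI = IsMaximalInvolution G

  ∈⟨MI⟩ : ∀ {x y} → MI x → y ∈⟨ x ⟩ → y ≡ ε ⊎ y ≡ x
  ∈⟨MI⟩ (_ , x²≡ε , _) = ∈⟨involution⟩ x²≡ε

  MI-neighbour≡ε : ∀ {x z} → MI x → Adj G x z → z ≡ ε
  MI-neighbour≡ε mi@(_ , _ , maximal) (x≢z , related) with ∈⟨MI⟩ mi ([ id , maximal _ ]′ related)
  ... | inj₁ z≡ε = z≡ε
  ... | inj₂ z≡x = ⊥-elim (x≢z (sym z≡x))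

  neighbours≡ε⇒MI : ∀ {x} → x ≢ ε → (∀ z → Adj G x z → z ≡ ε) → MI x
  neighbours≡ε⇒MI {x} x≢ε neighbours≡ε = x≢ε , x²≡ε , maximal
    where
    x²≡ε : x ∙ x ≡ ε
    x²≡ε with x ∙ x ≟ ε
    ... | yes x²≡ε = x²≡ε
    ... | no  x²≢ε = ⊥-elim (x≢ε (∈⟨ε⟩ (subst (x ∈⟨_⟩) (neighbours≡ε _ (Adj-⁻¹ x²≢ε)) (∈⟨⁻¹⟩ x))))
    maximal : ∀ y → x ∈⟨ y ⟩ → y ∈⟨ x ⟩
    maximal y x∈⟨y⟩ with y ≟ x
    ... | yes refl = ∈⟨⟩-refl x
    ... | no  y≢x  = ⊥-elim (x≢ε (∈⟨ε⟩ (subst (x ∈⟨_⟩) (neighbours≡ε y adj) x∈⟨y⟩)))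
      where adj = ≢-sym y≢x , inj₂ x∈⟨y⟩

  MI-openNbhdEq : ∀ {x y} → MI x → MI y → OpenNbhdEq G x y
  MI-openNbhdEq mi-x mi-y z = mk⇔
    (λ adj → subst (Adj G _) (sym (MI-neighbour≡ε mi-x adj)) (Adj-sym (ε-Adj (proj₁ mi-y))))
    (λ adj → subst (Adj G _) (sym (MI-neighbour≡ε mi-y adj)) (Adj-sym (ε-Adj (proj₁ mi-x))))

  nbhdEquiv⇒openNbhdEq : ∀ {x y} → ¬ Adj G y x → NbhdEquiv G x y → OpenNbhdEq G x y
  nbhdEquiv⇒openNbhdEq ¬adj (inj₁ open≡) = open≡
  nbhdEquiv⇒openNbhdEq ¬adj (inj₂ closed≡) with to (closed≡ _) (inj₁ refl)
  ... | inj₁ refl = λ _ → ⇔-id _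
  ... | inj₂ adj  = ⊥-elim (¬adj adj)

  twins⇒involution : ∀ {u v} → u ≢ v → ¬ Adj G u v → OpenNbhdEq G u v → IsInvolution u
  twins⇒involution {u} {v} u≢v ¬adj twins = u≢ε , u²≡ε
    where
    u≢ε : u ≢ ε
    u≢ε refl = ¬adj (u≢v , inj₂ (ε∈⟨⟩ v))
    u²≡ε : u ∙ u ≡ ε
    u²≡ε with u ∙ u ≟ ε
    ... | yes u²≡ε = u²≡ε
    ... | no  u²≢ε = ⊥-elim (¬adj (Adj-sym (Adj-⁻¹⇒Adj (≢-sym u≢v)
                                              (to (twins _) (Adj-⁻¹ u²≢ε)))))

  twins⇒MI : ∀ {u v} → u ≢ v → ¬ Adj G u v → OpenNbhdEq G u v → MI u
  twins⇒MI {u} u≢v ¬adj twins = proj₁ inv-u , proj₂ inv-u , maximal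
    where
    inv-u = twins⇒involution u≢v ¬adj twins
    inv-v = twins⇒involution (≢-sym u≢v) (¬adj ∘ Adj-sym) (⇔-sym ∘ twins)
    maximal : ∀ z → u ∈⟨ z ⟩ → z ∈⟨ u ⟩
    maximal z u∈⟨z⟩ with z ≟ u
    ... | yes refl = ∈⟨⟩-refl u
    ... | no  z≢u  with to (twins z) (≢-sym z≢u , inj₂ u∈⟨z⟩)
    ... | _ , inj₁ z∈⟨v⟩ = ⊥-elim (¬adj (u≢v , inj₂ (∈⟨⟩-trans u∈⟨z⟩ z∈⟨v⟩)))
    ... | _ , inj₂ v∈⟨z⟩ = ⊥-elim (u≢v (cyclic-involution-unique u∈⟨z⟩ v∈⟨z⟩ inv-u inv-v))

  anotherElement : ∀ {U : Pred (Elt G) 0ℓ} → HasTwoElements G U → ∀ t → ∃ λ u → u ∈ U × t ≢ u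
  anotherElement (a , b , a∈U , b∈U , a≢b) t with t ≟ a
  ... | yes refl = b , b∈U , a≢b
  ... | no  t≢a  = a , a∈U , t≢a

  IsMaximalInvolutionSet : Pred (Elt G) 0ℓ → Set
  IsMaximalInvolutionSet U = ∀ x → x ∈ U ⇔ MI x

  independentClass⇒maximalInvolutions : ∀ {U} → HasTwoElements G U →
    IsEquivClass G U × IsIndependent G U → IsMaximalInvolutionSet U
  independentClass⇒maximalInvolutions {U} two ((x₀ , class) , independent) x = mk⇔ MI-member member
    where
    x₀∈U : x₀ ∈ U
    x₀∈U = from (class x₀) (inj₁ λ _ → ⇔-id _)
    twinOfx₀ : ∀ {u} → u ∈ U → OpenNbhdEq G x₀ u
    twinOfx₀ u∈U = nbhdEquiv⇒openNbhdEq (independent _ _ u∈U x₀∈U) (to (class _) u∈U)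
    MI-member : ∀ {u} → u ∈ U → MI u
    MI-member {u} u∈U with v , v∈U , u≢v ← anotherElement two u =
      twins⇒MI u≢v (independent u v u∈U v∈U) (λ z → twinOfx₀ v∈U z ⇔-∘ ⇔-sym (twinOfx₀ u∈U z))
    member : MI x → x ∈ U
    member mi-x = from (class x) (inj₁ (MI-openNbhdEq (MI-member x₀∈U) mi-x))

  -- The second maximal involution b excludes y = ε, which is ≡ a when a is the only one.
  maximalInvolutions⇒independentClass : ∀ {U} → HasTwoElements G U →
    IsMaximalInvolutionSet U → IsEquivClass G U × IsIndependent G U
  maximalInvolutions⇒independentClass {U} (a , b , a∈U , b∈U , a≢b) mis =
    (a , λ y → mk⇔ (λ y∈U → inj₁ (MI-openNbhdEq mi-a (to (mis y) y∈U)))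
                   (λ a≈y → from (mis y) (equiv⇒MI a≈y))) ,
    λ x y x∈U y∈U adj → proj₁ (to (mis y) y∈U) (MI-neighbour≡ε (to (mis x) x∈U) adj)
    where
    mi-a = to (mis a) a∈U
    mi-b = to (mis b) b∈U
    equiv⇒MI : ∀ {y} → NbhdEquiv G a y → MI y
    equiv⇒MI {y} (inj₁ open≡) = neighbours≡ε⇒MI y≢ε λ z adj → MI-neighbour≡ε mi-a (from (open≡ z) adj)
      where
      y≢ε : y ≢ ε
      y≢ε refl = proj₁ (from (open≡ a) (ε-Adj (proj₁ mi-a))) refl
    equiv⇒MI (inj₂ closed≡) with from (closed≡ _) (inj₁ refl)
    ... | inj₁ refl = mi-a
    ... | inj₂ adj with MI-neighbour≡ε mi-a adj
    ... | refl with from (closed≡ b) (inj₂ (ε-Adj (proj₁ mi-b)))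
    ... | inj₁ b≡a  = ⊥-elim (a≢b (sym b≡a))
    ... | inj₂ adj′ = ⊥-elim (proj₁ mi-b (MI-neighbour≡ε mi-a adj′))

  module _ (_<ₗ_ : Rel (Elt G) 0ℓ) (isSTO : IsStrictTotalOrder _≡_ _<ₗ_) where
    open LG G _<ₗ_
    open IsStrictTotalOrder isSTO using (compare)

    ≼⇒∈⟨⟩ : ∀ {x y} → x ≼ y → x ∈⟨ y ⟩
    ≼⇒∈⟨⟩ (inj₁ (inj₁ ((x∈⟨y⟩ , _) , _))) = x∈⟨y⟩
    ≼⇒∈⟨⟩ (inj₁ (inj₂ (x∈⟨y⟩ , _)))       = x∈⟨y⟩
    ≼⇒∈⟨⟩ (inj₂ refl)                     = ∈⟨⟩-refl _

    ∈⟨⟩⇒¬incomparable : ∀ {x y} → x ∈⟨ y ⟩ → ¬ Incomparable x y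
    ∈⟨⟩⇒¬incomparable {x} {y} x∈⟨y⟩ (x⋠y , y⋠x) = x⋠y (inj₁ (inj₂ (x∈⟨y⟩ , ¬y∈⟨x⟩)))
      where
      ¬y∈⟨x⟩ : ¬ y ∈⟨ x ⟩
      ¬y∈⟨x⟩ y∈⟨x⟩ with compare x y
      ... | tri< x<y _ _ = x⋠y (inj₁ (inj₁ ((x∈⟨y⟩ , y∈⟨x⟩) , x<y)))
      ... | tri≈ _ x≡y _ = x⋠y (inj₂ x≡y)
      ... | tri> _ _ y<x = y⋠x (inj₁ (inj₁ ((y∈⟨x⟩ , x∈⟨y⟩) , y<x)))

    antichain-∈⟨⟩⇒≡ : ∀ {S x y} → IsAntichain S → x ∈ S → y ∈ S → x ∈⟨ y ⟩ → x ≡ y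
    antichain-∈⟨⟩⇒≡ {x = x} {y} antichain x∈S y∈S x∈⟨y⟩ with x ≟ y
    ... | yes x≡y = x≡y
    ... | no  x≢y = ⊥-elim (∈⟨⟩⇒¬incomparable x∈⟨y⟩ (antichain x y x∈S y∈S x≢y))

    homogeneous-comparable : ∀ {S y t u} → IsHomogeneous S → y ∉ S → t ∈ S →
                             ¬ Incomparable t y → u ∈ S → u ≼ y ⊎ y ≼ u
    homogeneous-comparable {y = y} {t} {u} homogeneous y∉S t∈S comparable u∈S
      with homogeneous y y∉S
    ... | inj₁ below                 = inj₁ (below u u∈S)
    ... | inj₂ (inj₁ above)          = inj₂ (above u u∈S)
    ... | inj₂ (inj₂ incomparable)   = ⊥-elim (comparable (incomparable t t∈S))

    maximalInvolutions⇒homogeneousAntichain : ∀ {S} → IsMaximalInvolutionSet S →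
                                              IsHomogeneousAntichain S
    maximalInvolutions⇒homogeneousAntichain {S} mis = antichain , homogeneous
      where
      ≼MI⇒≡ : ∀ {x y} → x ∈ S → y ∈ S → x ≼ y → x ≡ y
      ≼MI⇒≡ {x} {y} x∈S y∈S x≼y with ∈⟨MI⟩ (to (mis y) y∈S) (≼⇒∈⟨⟩ x≼y)
      ... | inj₁ x≡ε = ⊥-elim (proj₁ (to (mis x) x∈S) x≡ε)
      ... | inj₂ x≡y = x≡y
      antichain : IsAntichain S
      antichain x y x∈S y∈S x≢y = (λ x≼y → x≢y (≼MI⇒≡ x∈S y∈S x≼y))
                                , (λ y≼x → x≢y (sym (≼MI⇒≡ y∈S x∈S y≼x)))
      homogeneous : IsHomogeneous S
      homogeneous y y∉S with y ≟ ε
      ... | yes refl = inj₂ (inj₁ λ x x∈S →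
                         inj₁ (inj₂ (ε∈⟨⟩ x , λ x∈⟨ε⟩ → proj₁ (to (mis x) x∈S) (∈⟨ε⟩ x∈⟨ε⟩))))
      ... | no  y≢ε  = inj₂ (inj₂ λ x x∈S →
                         let _ , _ , maximal = to (mis x) x∈S
                         in (λ x≼y → y∉⟨MI⟩ x∈S (maximal y (≼⇒∈⟨⟩ x≼y)))
                          , (λ y≼x → y∉⟨MI⟩ x∈S (≼⇒∈⟨⟩ y≼x)))
        where
        y∉⟨MI⟩ : ∀ {x} → x ∈ S → ¬ y ∈⟨ x ⟩
        y∉⟨MI⟩ {x} x∈S y∈⟨x⟩ with ∈⟨MI⟩ (to (mis x) x∈S) y∈⟨x⟩
        ... | inj₁ y≡ε = y≢ε y≡ε
        ... | inj₂ refl = y∉S x∈S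

    homogeneousAntichain⇒involution : ∀ {S t u} → IsHomogeneousAntichain S →
                                      t ∈ S → u ∈ S → t ≢ u → IsInvolution t
    homogeneousAntichain⇒involution {S} {t} {u} (antichain , homogeneous) t∈S u∈S t≢u =
      t≢ε , t²≡ε
      where
      t≢ε : t ≢ ε
      t≢ε refl = t≢u (antichain-∈⟨⟩⇒≡ antichain t∈S u∈S (ε∈⟨⟩ u))
      t²≡ε : t ∙ t ≡ ε
      t²≡ε with t ∙ t ≟ ε
      ... | yes t²≡ε = t²≡ε
      ... | no  t²≢ε with homogeneous-comparable homogeneous t⁻¹∉S t∈S
                            (∈⟨⟩⇒¬incomparable (∈⟨⁻¹⟩ t)) u∈S
        where
        t⁻¹∉S : t ⁻¹ ∉ S
        t⁻¹∉S t⁻¹∈S = ⁻¹≢ t²≢ε (antichain-∈⟨⟩⇒≡ antichain t⁻¹∈S t∈S (⁻¹∈⟨⟩ t))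
      ... | inj₁ u≼t⁻¹ = ⊥-elim (t≢u (sym (antichain-∈⟨⟩⇒≡ antichain u∈S t∈S
                                            (∈⟨⟩-trans (≼⇒∈⟨⟩ u≼t⁻¹) (⁻¹∈⟨⟩ t)))))
      ... | inj₂ t⁻¹≼u = ⊥-elim (t≢u (antichain-∈⟨⟩⇒≡ antichain t∈S u∈S
                                       (∈⟨⟩-trans (∈⟨⁻¹⟩ t) (≼⇒∈⟨⟩ t⁻¹≼u))))

    homogeneousAntichain⇒MI : ∀ {S t u} → IsHomogeneousAntichain S →
                              t ∈ S → u ∈ S → t ≢ u → MI t
    homogeneousAntichain⇒MI {S} {t} {u} ha@(antichain , homogeneous) t∈S u∈S t≢u =
      proj₁ inv-t , proj₂ inv-t , maximal
      where
      inv-t = homogeneousAntichain⇒involution ha t∈S u∈S t≢u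
      inv-u = homogeneousAntichain⇒involution ha u∈S t∈S (≢-sym t≢u)
      maximal : ∀ z → t ∈⟨ z ⟩ → z ∈⟨ t ⟩
      maximal z t∈⟨z⟩ with z ≟ t
      ... | yes refl = ∈⟨⟩-refl t
      ... | no  z≢t  with homogeneous-comparable homogeneous z∉S t∈S
                            (∈⟨⟩⇒¬incomparable t∈⟨z⟩) u∈S
        where
        z∉S : z ∉ S
        z∉S z∈S = z≢t (sym (antichain-∈⟨⟩⇒≡ antichain t∈S z∈S t∈⟨z⟩))
      ... | inj₁ u≼z = ⊥-elim (t≢u (cyclic-involution-unique t∈⟨z⟩ (≼⇒∈⟨⟩ u≼z) inv-t inv-u))
      ... | inj₂ z≼u = ⊥-elim (t≢u (antichain-∈⟨⟩⇒≡ antichain t∈S u∈S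
                                      (∈⟨⟩-trans t∈⟨z⟩ (≼⇒∈⟨⟩ z≼u))))

    maximalInvolutions⇒maximalHomogeneousAntichain : ∀ {U} → HasTwoElements G U →
      IsMaximalInvolutionSet U → IsMaximalHomogeneousAntichain U
    maximalInvolutions⇒maximalHomogeneousAntichain two mis =
      maximalInvolutions⇒homogeneousAntichain mis , λ T haT U⊆T {t} t∈T →
        let u , u∈U , t≢u = anotherElement two t
        in from (mis t) (homogeneousAntichain⇒MI haT t∈T (U⊆T u∈U) t≢u)

    maximalHomogeneousAntichain⇒maximalInvolutions : ∀ {U} → HasTwoElements G U →
      IsMaximalHomogeneousAntichain U → IsMaximalInvolutionSet U
    maximalHomogeneousAntichain⇒maximalInvolutions {U} two (haU , maximal) x =
      mk⇔ MI-member (maximal MI (maximalInvolutions⇒homogeneousAntichain λ _ → ⇔-id _) MI-member)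
      where
      MI-member : ∀ {y} → y ∈ U → MI y
      MI-member {y} y∈U = let u , u∈U , y≢u = anotherElement two y
                          in homogeneousAntichain⇒MI haU y∈U u∈U y≢u

proposition3p4 : (G : FiniteGroup) (_<ₗ_ : Rel (Elt G) 0ℓ) → IsStrictTotalOrder _≡_ _<ₗ_ → (U : Pred (Elt G) 0ℓ) → HasTwoElements G U
    → ((IsEquivClass G U × IsIndependent G U) ⇔ (∀ x → (x ∈ U ⇔ IsMaximalInvolution G x)))
    × ((∀ x → (x ∈ U ⇔ IsMaximalInvolution G x)) ⇔ LG.IsMaximalHomogeneousAntichain G _<ₗ_ U)
proposition3p4 G _<ₗ_ isSTO U two =
  mk⇔ (independentClass⇒maximalInvolutions G two) (maximalInvolutions⇒independentClass G two) ,
  mk⇔ (maximalInvolutions⇒maximalHomogeneousAntichain G _<ₗ_ isSTO two)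
      (maximalHomogeneousAntichain⇒maximalInvolutions G _<ₗ_ isSTO two)
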